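{- Let $f : 2^{\mathcal{N}} \to \mathbb{R}^+$ be a non-negative monotone submodular function and $\mathcal{M} = (\mathcal{N}, \mathcal{I})$ a matroid of rank $k$, and assume $f(\{u\}) \le \max\{f(T): T\in\mathcal{I}\}$ for every $u\in\mathcal{N}$. There exists a $(1/3)$-approximation algorithm for $\max\{f(S) : S \in \mathcal{I}\}$, i.e., an algorithm outputting $S\in\mathcal{I}$ with $f(S)\ge \frac13\max\{f(T):T\in\mathcal{I}\}$, which uses $O(n \ln k)$ value oracle queries and $O(n\ln k)$ independence oracle queries.
   Context: $\mathcal{N}$ is a finite ground set with $n = |\mathcal{N}|$; $f$ is submodular ($f(A)+f(B) \ge f(A\cup B)+f(A\cap B)$) and monotone. The algorithm accesses $f$ via a value oracle (returning $f(S)$) and $\mathcal{M}$ via an independence oracle (answering whether $S\in\mathcal{I}$).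
   Formalization: The function f takes rational values instead of values in $\mathbb{R}^+$, so the value oracle answers are rationals. -}

module Defs where

open import Data.Nat using (ℕ; zero; suc; _+_; _*_) renaming (_≤_ to _≤ℕ_; _<_ to _<ℕ_)
open import Data.Nat.Logarithm using (⌊log₂_⌋)
open import Data.Bool using (Bool; true; false)
open import Data.Fin using (Fin)
open import Data.Fin.Subset using (Subset; _∈_; _∉_; _⊆_; _∪_; _∩_; ∣_∣; ⁅_⁆; ⊥)
open import Data.Rational using (ℚ; 0ℚ) renaming (_+_ to _+ℚ_; _≤_ to _≤ℚ_)
open import Data.Product using (Σ; _×_; ∃; ∃-syntax)
open import Relation.Binary.PropositionalEquality using (_≡_)

SetFn : ℕ → Set
SetFn n = Subset n → ℚ

NonNegative : ∀ {n} → SetFn n → Set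
NonNegative f = ∀ A → 0ℚ ≤ℚ f A

Monotone : ∀ {n} → SetFn n → Set
Monotone f = ∀ A B → A ⊆ B → f A ≤ℚ f B

Submodular : ∀ {n} → SetFn n → Set
Submodular f = ∀ A B → (f (A ∪ B) +ℚ f (A ∩ B)) ≤ℚ (f A +ℚ f B)

-- Independence system given by a Boolean-valued predicate (this is what the
-- independence oracle answers).
Indep : ∀ {n} → (Subset n → Bool) → Subset n → Set
Indep ind S = ind S ≡ true

record IsMatroid {n : ℕ} (ind : Subset n → Bool) : Set where
  field
    empty-indep : Indep ind ⊥
    hereditary  : ∀ A B → A ⊆ B → Indep ind B → Indep ind A
    exchange    : ∀ A B → Indep ind A → Indep ind B → ∣ A ∣ <ℕ ∣ B ∣ →
                  ∃[ x ] (x ∈ B × x ∉ A × Indep ind (A ∪ ⁅ x ⁆))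

HasRank : ∀ {n} → (Subset n → Bool) → ℕ → Set
HasRank ind k = (∃[ B ] (Indep ind B × ∣ B ∣ ≡ k)) × (∀ B → Indep ind B → ∣ B ∣ ≤ℕ k)

-- Adaptive oracle algorithms on ground set Fin n, as query trees:
-- a value query on S continues with a function of the answer f(S);
-- an independence query on S continues with a function of the answer.
data Alg (n : ℕ) : Set where
  ret  : Subset n → Alg n
  valQ : Subset n → (ℚ → Alg n) → Alg n
  indQ : Subset n → (Bool → Alg n) → Alg n

run : ∀ {n} → Alg n → SetFn n → (Subset n → Bool) → Subset n
run (ret S)    f ind = S
run (valQ S k) f ind = run (k (f S)) f ind
run (indQ S k) f ind = run (k (ind S)) f ind

#valQ : ∀ {n} → Alg n → SetFn n → (Subset n → Bool) → ℕ
#valQ (ret S)    f ind = 0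
#valQ (valQ S k) f ind = suc (#valQ (k (f S)) f ind)
#valQ (indQ S k) f ind = #valQ (k (ind S)) f ind

#indQ : ∀ {n} → Alg n → SetFn n → (Subset n → Bool) → ℕ
#indQ (ret S)    f ind = 0
#indQ (valQ S k) f ind = #indQ (k (f S)) f ind
#indQ (indQ S k) f ind = suc (#indQ (k (ind S)) f ind)

-- The query budget C · n · (1 + ⌊log₂ k⌋), i.e. O(n ln k) (with the usual
-- convention that the bound is at least of order n when k ≤ 1).
budget : ℕ → ℕ → ℕ → ℕ
budget C n k = C * (n * suc ⌊log₂ k ⌋)

{-# OPTIONS --safe #-}
module Submission where

-- Greedy over all elements finds a basis, hence the rank k, with n independence queries, and n value
-- queries find d = max f({u}) ≤ OPT. Then 2(⌊log₂ k⌋ + 6) passes of threshold greedy follow, with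
-- thresholds 2u for u = d, qd, q²d, … and q = 2/3: x joins the independent set S if S + x is
-- independent and f(S + x) ≥ f(S) + 2u. After a pass every independent extension of S gains less than
-- 2u = 3qu, so during a pass with threshold 2u all gains are at most 3u. For each independent T we keep
-- a set O with S ∪ O independent and 2 f(T) ≤ 2 f(S ∪ O) + 3 f(S): when x joins S, the exchange
-- property removes at most one element of O, which by submodularity costs at most 3u of f(S ∪ O),
-- while 3 f(S) grows by at least 6u. In the end submodularity gives f(S ∪ O) ≤ f(S) + k U, with U the
-- final bound on gains, so 2 f(T) ≤ 5 f(S) + 2 k U; since 6 k U ≤ d ≤ OPT and 5/2 < 3, OPT ≤ 3 f(S).

open import Defs
open import Agda.Builtin.FromNat using (Number; fromNat)
open import Algebra.Bundles using (CommutativeRing)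
open import Data.Bool using (Bool; true; false; if_then_else_)
open import Data.Empty using (⊥-elim)
import Data.Integer as ℤ
open import Data.Fin using (Fin; zero; suc) renaming (_≟_ to _≟ᶠ_)
open import Data.Fin.Properties using (any?)
open import Data.Fin.Subset using (Subset; inside; outside; _∈_; _∉_; _⊆_; _∪_; _∩_; _-_; ∣_∣; ⁅_⁆; ⊥)
open import Data.Fin.Subset.Properties
  using ( x∈⁅x⁆; x∈⁅y⁆⇒x≡y; x∈p∪q⁻; x∈p∩q⁺; p⊆p∪q; q⊆p∪q; ∪-identityˡ; ∪-identityʳ; ∪-assoc
        ; x∈p∧x≢y⇒x∈p-y; p─q⊆p; p⊆q⇒∣p∣≤∣q∣; p⊂q⇒∣p∣<∣q∣; x∈p⇒∣p-x∣<∣p∣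
        ; ⊆-refl; ⊆-reflexive; ⊆-trans; _∈?_; nonempty? )
open import Data.List using (List; []; _∷_; length; allFin)
open import Data.List.Properties using (length-tabulate)
open import Data.List.Membership.Propositional using () renaming (_∈_ to _∈ₗ_)
open import Data.List.Membership.Propositional.Properties using (∈-allFin)
open import Data.List.Relation.Unary.Any using (here; there)
open import Data.Nat as ℕ using (ℕ; zero; suc; z≤n; s≤s) renaming (_≤_ to _≤ℕ_; _<_ to _<ℕ_)
import Data.Nat.Literals as ℕ
open import Data.Nat.Logarithm using (⌊log₂_⌋; ⌊log₂⌋-mono-≤; ⌊log₂[2^n]⌋≡n)
import Data.Nat.Properties as ℕ
open import Data.Nat.Tactic.RingSolver using () renaming (solve-∀ to ℕ-solve-∀)
open import Data.Product using (Σ; _×_; _,_; proj₁; proj₂; ∃-syntax)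
open import Data.Rational using (ℚ; 0ℚ; 1ℚ; _+_; _*_; -_; _/_; _≤_; _⊔_; nonNegative)
open import Data.Rational using () renaming (_+_ to _+ℚ_; _≤_ to _≤ℚ_)
import Data.Rational.Literals as ℚ
open import Data.Rational.Properties
  using ( ≤-refl; ≤-trans; +-mono-≤; +-monoˡ-≤; +-monoʳ-≤; *-monoˡ-≤-nonNeg; *-monoʳ-≤-nonNeg; *-cancelˡ-≤-pos
        ; +-comm; +-identityʳ; *-identityˡ; *-identityʳ; *-zeroʳ; *-assoc
        ; ≤ᵇ⇒≤; ≰⇒>; <⇒≤; _≤?_; ⊔-sel; p≤p⊔q; p≤q⊔p; p≤q⇒p≤q⊔r; +-*-commutativeRing; module ≤-Reasoning )
  renaming (_≟_ to _≟ℚ_)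
open import Algebra.Properties.CommutativeSemiring.Exp (CommutativeRing.commutativeSemiring +-*-commutativeRing)
  using (_^_; ^-assocʳ; ^-distrib-*)
open import Algebra.Properties.Semiring.Mult (CommutativeRing.semiring +-*-commutativeRing)
  using (×1-homo-*) renaming (_×_ to _×ℚ_)
open import Data.Sum using (_⊎_; inj₁; inj₂; [_,_]; [_,_]′)
open import Data.Unit using (tt)
open import Data.Vec using (_∷_; here; there)
open import Function using (_∘_; id)
open import Relation.Binary.PropositionalEquality
  using (_≡_; _≢_; refl; sym; trans; cong; cong₂; subst; subst₂; module ≡-Reasoning)
open import Relation.Nullary using (¬_; Dec; yes; no; does; contradiction; ¬?)
open import Relation.Nullary.Decidable using (dec⇒maybe; _×-dec_; decidable-stable)
open import Tactic.RingSolver using (solve-∀)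
open import Tactic.RingSolver.Core.AlmostCommutativeRing using (AlmostCommutativeRing; fromCommutativeRing)

instance
  ℕ-number : Number ℕ
  ℕ-number = ℕ.number

  ℚ-number : Number ℚ
  ℚ-number = ℚ.number

ℚ-ring : AlmostCommutativeRing _ _
ℚ-ring = fromCommutativeRing +-*-commutativeRing (λ x → dec⇒maybe (0ℚ ≟ℚ x))

+-cancelʳ-≤ : ∀ {p q} r → p + r ≤ q + r → p ≤ q
+-cancelʳ-≤ {p} {q} r p+r≤q+r = subst₂ _≤_ (cancel p r) (cancel q r) (+-monoˡ-≤ (- r) p+r≤q+r)
  where
  cancel : ∀ x y → x + y + - y ≡ x
  cancel = solve-∀ ℚ-ring

0≤1 : 0ℚ ≤ 1ℚ
0≤1 = ≤ᵇ⇒≤ tt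

p≤p+q : ∀ {p q} → 0ℚ ≤ q → p ≤ p + q
p≤p+q {p} 0≤q = subst (_≤ p + _) (+-identityʳ p) (+-monoʳ-≤ p 0≤q)

0≤p∧0≤q⇒0≤p*q : ∀ {p q} → 0ℚ ≤ p → 0ℚ ≤ q → 0ℚ ≤ p * q
0≤p∧0≤q⇒0≤p*q {p} {q} 0≤p 0≤q = subst (_≤ p * q) (*-zeroʳ p) (*-monoˡ-≤-nonNeg p {{nonNegative 0≤p}} 0≤q)

x∈p-y⇒x≢y : ∀ {n} (p : Subset n) {x y : Fin n} → x ∈ p - y → x ≢ y
x∈p-y⇒x≢y (_ ∷ p) {zero}  {zero}   ()          refl
x∈p-y⇒x≢y (_ ∷ p) {suc x} {suc .x} (there x∈) refl = x∈p-y⇒x≢y p x∈ refl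

x∉p⇒∣p∪⁅x⁆∣≡1+∣p∣ : ∀ {n} (p : Subset n) (x : Fin n) → x ∉ p → ∣ p ∪ ⁅ x ⁆ ∣ ≡ suc ∣ p ∣
x∉p⇒∣p∪⁅x⁆∣≡1+∣p∣ (inside  ∷ p) zero    x∉p = contradiction here x∉p
x∉p⇒∣p∪⁅x⁆∣≡1+∣p∣ (outside ∷ p) zero    _   = cong (suc ∘ ∣_∣) (∪-identityʳ p)
x∉p⇒∣p∪⁅x⁆∣≡1+∣p∣ (inside  ∷ p) (suc x) x∉p = cong suc (x∉p⇒∣p∪⁅x⁆∣≡1+∣p∣ p x (x∉p ∘ there))
x∉p⇒∣p∪⁅x⁆∣≡1+∣p∣ (outside ∷ p) (suc x) x∉p = x∉p⇒∣p∪⁅x⁆∣≡1+∣p∣ p x (x∉p ∘ there)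

module _ {n : ℕ} where

  ∪-lub : {p q r : Subset n} → p ⊆ r → q ⊆ r → p ∪ q ⊆ r
  ∪-lub {p} {q} p⊆r q⊆r = [ p⊆r , q⊆r ] ∘ x∈p∪q⁻ p q

  ∪-mono : {p p′ q q′ : Subset n} → p ⊆ p′ → q ⊆ q′ → p ∪ q ⊆ p′ ∪ q′
  ∪-mono {q′ = q′} p⊆p′ q⊆q′ = ∪-lub (p⊆p∪q q′ ∘ p⊆p′) (q⊆p∪q _ q′ ∘ q⊆q′)

  x∈p⇒⁅x⁆⊆p : {p : Subset n} {x : Fin n} → x ∈ p → ⁅ x ⁆ ⊆ p
  x∈p⇒⁅x⁆⊆p {p} {x} x∈p y∈⁅x⁆ = subst (_∈ p) (sym (x∈⁅y⁆⇒x≡y x y∈⁅x⁆)) x∈p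

  p⊆p-x∪⁅x⁆ : (p : Subset n) (x : Fin n) → p ⊆ (p - x) ∪ ⁅ x ⁆
  p⊆p-x∪⁅x⁆ p x {y} y∈p with y ≟ᶠ x
  ... | yes refl = q⊆p∪q (p - x) ⁅ x ⁆ (x∈⁅x⁆ x)
  ... | no y≢x   = p⊆p∪q ⁅ x ⁆ (x∈p∧x≢y⇒x∈p-y y∈p y≢x)

  ⊆-or-∉ : (p q : Subset n) → p ⊆ q ⊎ ∃[ x ] (x ∈ p × x ∉ q)
  ⊆-or-∉ p q with any? (λ x → (x ∈? p) ×-dec ¬? (x ∈? q))
  ... | yes witness = inj₂ witness
  ... | no none     = inj₁ λ {x} x∈p → decidable-stable (x ∈? q) (λ x∉q → none (x , x∈p , x∉q))

  ∣p∪⁅x⁆∣≤1+∣p∣ : (p : Subset n) (x : Fin n) → ∣ p ∪ ⁅ x ⁆ ∣ ≤ℕ suc ∣ p ∣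
  ∣p∪⁅x⁆∣≤1+∣p∣ p x with x ∈? p
  ... | yes x∈p = ℕ.m≤n⇒m≤1+n (p⊆q⇒∣p∣≤∣q∣ (∪-lub ⊆-refl (x∈p⇒⁅x⁆⊆p x∈p)))
  ... | no  x∉p = ℕ.≤-reflexive (x∉p⇒∣p∪⁅x⁆∣≡1+∣p∣ p x x∉p)

  p⊆q∧∣q∣≤∣p∣⇒q⊆p : {p q : Subset n} → p ⊆ q → ∣ q ∣ ≤ℕ ∣ p ∣ → q ⊆ p
  p⊆q∧∣q∣≤∣p∣⇒q⊆p {p} p⊆q ∣q∣≤∣p∣ {x} x∈q with x ∈? p
  ... | yes x∈p = x∈p
  ... | no  x∉p = contradiction (p⊂q⇒∣p∣<∣q∣ (p⊆q , x , x∈q , x∉p)) (ℕ.≤⇒≯ ∣q∣≤∣p∣)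

module _ {n : ℕ} {f : SetFn n} (mono : Monotone f) (submod : Submodular f) where

  diminishing-returns : ∀ {S X : Subset n} y → S ⊆ X → f (X ∪ ⁅ y ⁆) + f S ≤ f X + f (S ∪ ⁅ y ⁆)
  diminishing-returns {S} {X} y S⊆X = begin
    f (X ∪ ⁅ y ⁆) + f S                          ≤⟨ +-mono-≤ (mono _ _ X∪y⊆) (mono _ _ S⊆) ⟩
    f ((S ∪ ⁅ y ⁆) ∪ X) + f ((S ∪ ⁅ y ⁆) ∩ X)   ≤⟨ submod (S ∪ ⁅ y ⁆) X ⟩
    f (S ∪ ⁅ y ⁆) + f X                          ≡⟨ +-comm (f (S ∪ ⁅ y ⁆)) (f X) ⟩
    f X + f (S ∪ ⁅ y ⁆)                          ∎
    where
    open ≤-Reasoning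
    X∪y⊆ : X ∪ ⁅ y ⁆ ⊆ (S ∪ ⁅ y ⁆) ∪ X
    X∪y⊆ = ∪-lub (q⊆p∪q _ X) (p⊆p∪q X ∘ q⊆p∪q S ⁅ y ⁆)
    S⊆ : S ⊆ (S ∪ ⁅ y ⁆) ∩ X
    S⊆ s∈S = x∈p∩q⁺ (p⊆p∪q ⁅ y ⁆ s∈S , S⊆X s∈S)

module MatroidProperties {n : ℕ} {ind : Subset n → Bool} (M : IsMatroid ind) where
  open IsMatroid M

  augment-within : ∀ m {X Y} → Indep ind X → Indep ind Y → ∣ X ∣ ≤ℕ m ℕ.+ ∣ Y ∣ →
                   ∃[ Z ] (Indep ind Z × Y ⊆ Z × Z ⊆ Y ∪ X × ∣ X ∣ ≤ℕ ∣ Z ∣)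
  augment-within zero    {X} {Y} _ iY ∣X∣≤∣Y∣ = Y , iY , ⊆-refl , p⊆p∪q X , ∣X∣≤∣Y∣
  augment-within (suc m) {X} {Y} iX iY ∣X∣≤ with ∣ X ∣ ℕ.≤? ∣ Y ∣
  ... | yes ∣X∣≤∣Y∣ = Y , iY , ⊆-refl , p⊆p∪q X , ∣X∣≤∣Y∣
  ... | no  ∣X∣≰∣Y∣ with exchange Y X iY iX (ℕ.≰⇒> ∣X∣≰∣Y∣)
  ...   | x , x∈X , x∉Y , iYx with augment-within m iX iYx (subst (∣ X ∣ ≤ℕ_) ∣Y∪x∣+m ∣X∣≤)
    where
    ∣Y∪x∣+m : suc m ℕ.+ ∣ Y ∣ ≡ m ℕ.+ ∣ Y ∪ ⁅ x ⁆ ∣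
    ∣Y∪x∣+m = trans (sym (ℕ.+-suc m ∣ Y ∣)) (cong (m ℕ.+_) (sym (x∉p⇒∣p∪⁅x⁆∣≡1+∣p∣ Y x x∉Y)))
  ...     | Z , iZ , Y∪x⊆Z , Z⊆Y∪x∪X , ∣X∣≤∣Z∣ =
    Z , iZ , Y∪x⊆Z ∘ p⊆p∪q ⁅ x ⁆ , ⊆-trans Z⊆Y∪x∪X (∪-lub (∪-mono ⊆-refl (x∈p⇒⁅x⁆⊆p x∈X)) (q⊆p∪q Y X)) , ∣X∣≤∣Z∣

  augment : ∀ {X Y} → Indep ind X → Indep ind Y → ∃[ Z ] (Indep ind Z × Y ⊆ Z × Z ⊆ Y ∪ X × ∣ X ∣ ≤ℕ ∣ Z ∣)
  augment {X} {Y} iX iY = augment-within ∣ X ∣ iX iY (ℕ.m≤m+n ∣ X ∣ ∣ Y ∣)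

  exchange-into : ∀ {X S s} → Indep ind X → S ⊆ X → Indep ind (S ∪ ⁅ s ⁆) → ¬ Indep ind (X ∪ ⁅ s ⁆) →
                  ∃[ o ] (o ∈ X × o ∉ S ∪ ⁅ s ⁆ × Indep ind ((X ∪ ⁅ s ⁆) - o))
  exchange-into {X} {S} {s} iX S⊆X iS∪s dependent with augment iX iS∪s
  ... | Z , iZ , S∪s⊆Z , Z⊆S∪s∪X , ∣X∣≤∣Z∣ with ⊆-or-∉ (X ∪ ⁅ s ⁆) Z
  ...   | inj₁ X∪s⊆Z = contradiction (hereditary _ _ X∪s⊆Z iZ) dependent
  ...   | inj₂ (o , o∈X∪s , o∉Z) = o , o∈X , o∉S∪s , hereditary _ _ X∪s-o⊆Z iZ
    where
    o∉S∪s : o ∉ S ∪ ⁅ s ⁆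
    o∉S∪s = o∉Z ∘ S∪s⊆Z
    o∈X : o ∈ X
    o∈X = [ id , (λ o∈s → contradiction (q⊆p∪q S ⁅ s ⁆ o∈s) o∉S∪s) ] (x∈p∪q⁻ X ⁅ s ⁆ o∈X∪s)
    Z⊆X∪s-o : Z ⊆ (X ∪ ⁅ s ⁆) - o
    Z⊆X∪s-o z∈Z = x∈p∧x≢y⇒x∈p-y (∪-lub (∪-mono S⊆X ⊆-refl) (p⊆p∪q ⁅ s ⁆) (Z⊆S∪s∪X z∈Z)) (λ { refl → o∉Z z∈Z })
    X∪s-o⊆Z : (X ∪ ⁅ s ⁆) - o ⊆ Z
    X∪s-o⊆Z = p⊆q∧∣q∣≤∣p∣⇒q⊆p Z⊆X∪s-o
      (ℕ.≤-trans (ℕ.≤-pred (ℕ.<-≤-trans (x∈p⇒∣p-x∣<∣p∣ o∈X∪s) (∣p∪⁅x⁆∣≤1+∣p∣ X s))) ∣X∣≤∣Z∣)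

  maximal⇒∣B∣≡rank : ∀ {B k} → HasRank ind k → Indep ind B → (∀ x → Indep ind (B ∪ ⁅ x ⁆) → x ∈ B) → ∣ B ∣ ≡ k
  maximal⇒∣B∣≡rank {B} {k} ((B′ , iB′ , ∣B′∣≡k) , rank-bound) iB maximal =
    ℕ.≤-antisym (rank-bound B iB) (ℕ.≮⇒≥ ∣B∣≮k)
    where
    ∣B∣≮k : ¬ ∣ B ∣ <ℕ k
    ∣B∣≮k ∣B∣<k with exchange B B′ iB iB′ (subst (∣ B ∣ <ℕ_) (sym ∣B′∣≡k) ∣B∣<k)
    ... | x , _ , x∉B , iBx = x∉B (maximal x iBx)

data Oracle : Set where
  value indep : Oracle

Answer : Oracle → Set
Answer value = ℚ
Answer indep = Bool

-- Query trees with results of any type, so that the phases of the algorithm compose by _>>=_.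
data Query (n : ℕ) (A : Set) : Set where
  pure : A → Query n A
  ask  : (o : Oracle) → Subset n → (Answer o → Query n A) → Query n A

_>>=_ : ∀ {n} {A B : Set} → Query n A → (A → Query n B) → Query n B
pure a    >>= g = g a
ask o S k >>= g = ask o S (λ a → k a >>= g)

foldM : ∀ {n} {A B : Set} → (B → A → Query n B) → B → List A → Query n B
foldM step b []       = pure b
foldM step b (x ∷ xs) = step b x >>= λ b′ → foldM step b′ xs

query : ∀ {n} (o : Oracle) → Subset n → Query n (Answer o)
query o S = ask o S pure

toAlg : ∀ {n} → Query n (Subset n) → Alg n
toAlg (pure S)        = ret S
toAlg (ask value S k) = valQ S (toAlg ∘ k)
toAlg (ask indep S k) = indQ S (toAlg ∘ k)

δ : Oracle → Oracle → ℕ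
δ value value = 1
δ indep indep = 1
δ _     _     = 0

δ≤1 : ∀ o o′ → δ o o′ ≤ℕ 1
δ≤1 value value = s≤s z≤n
δ≤1 value indep = z≤n
δ≤1 indep value = z≤n
δ≤1 indep indep = s≤s z≤n

module Semantics {n : ℕ} (f : SetFn n) (ind : Subset n → Bool) where

  answer : (o : Oracle) → Subset n → Answer o
  answer value = f
  answer indep = ind

  eval : ∀ {A} → Query n A → A
  eval (pure a)    = a
  eval (ask o S k) = eval (k (answer o S))

  count : ∀ {A} → Oracle → Query n A → ℕ
  count o (pure _)     = 0
  count o (ask o′ S k) = δ o o′ ℕ.+ count o (k (answer o′ S))

  eval->>= : ∀ {A B} (p : Query n A) (g : A → Query n B) → eval (p >>= g) ≡ eval (g (eval p))
  eval->>= (pure a)    g = refl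
  eval->>= (ask o S k) g = eval->>= (k (answer o S)) g

  count->>= : ∀ {A B} o (p : Query n A) (g : A → Query n B) → count o (p >>= g) ≡ count o p ℕ.+ count o (g (eval p))
  count->>= o (pure a)     g = refl
  count->>= o (ask o′ S k) g =
    trans (cong (δ o o′ ℕ.+_) (count->>= o (k (answer o′ S)) g)) (sym (ℕ.+-assoc (δ o o′) _ _))

  module _ {A B : Set} {step : B → A → Query n B} where

    foldM-preserves : (P : B → Set) → (∀ {b} x → P b → P (eval (step b x))) →
                      ∀ xs {b} → P b → P (eval (foldM step b xs))
    foldM-preserves P preserve []       Pb = Pb
    foldM-preserves P preserve (x ∷ xs) {b} Pb =
      subst P (sym (eval->>= (step b x) _)) (foldM-preserves P preserve xs (preserve x Pb))

    foldM-establishes : (Inv : B → Set) (Done : A → B → Set) →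
                        (∀ {b} x → Inv b → Inv (eval (step b x))) →
                        (∀ {b} x → Inv b → Done x (eval (step b x))) →
                        (∀ {b} x y → Inv b → Done y b → Done y (eval (step b x))) →
                        ∀ xs {b} → Inv b → ∀ {y} → y ∈ₗ xs → Done y (eval (foldM step b xs))
    foldM-establishes Inv Done preserve establish keep (x ∷ xs) {b} Inv-b y∈ =
      subst (Done _) (sym (eval->>= (step b x) _)) (after-step y∈)
      where
      after-step : ∀ {y} → y ∈ₗ x ∷ xs → Done y (eval (foldM step (eval (step b x)) xs))
      after-step (here refl) =
        proj₂ (foldM-preserves (λ b → Inv b × Done x b) (λ z (i , d) → preserve z i , keep z x i d) xs
                               (preserve x Inv-b , establish x Inv-b))
      after-step (there y∈xs) = foldM-establishes Inv Done preserve establish keep xs (preserve x Inv-b) y∈xs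

    count-foldM : ∀ o c → (∀ b x → count o (step b x) ≤ℕ c) → ∀ xs b → count o (foldM step b xs) ≤ℕ length xs ℕ.* c
    count-foldM o c bounded []       b = z≤n
    count-foldM o c bounded (x ∷ xs) b = begin
      count o (step b x >>= λ b′ → foldM step b′ xs)                  ≡⟨ count->>= o (step b x) _ ⟩
      count o (step b x) ℕ.+ count o (foldM step (eval (step b x)) xs) ≤⟨ ℕ.+-mono-≤ (bounded b x) (count-foldM o c bounded xs _) ⟩
      c ℕ.+ length xs ℕ.* c                                            ∎
      where open ℕ.≤-Reasoning

  run-toAlg : (p : Query n (Subset n)) → run (toAlg p) f ind ≡ eval p
  run-toAlg (pure S)        = refl
  run-toAlg (ask value S k) = run-toAlg (k (f S))
  run-toAlg (ask indep S k) = run-toAlg (k (ind S))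

  #valQ-toAlg : (p : Query n (Subset n)) → #valQ (toAlg p) f ind ≡ count value p
  #valQ-toAlg (pure S)        = refl
  #valQ-toAlg (ask value S k) = cong suc (#valQ-toAlg (k (f S)))
  #valQ-toAlg (ask indep S k) = #valQ-toAlg (k (ind S))

  #indQ-toAlg : (p : Query n (Subset n)) → #indQ (toAlg p) f ind ≡ count indep p
  #indQ-toAlg (pure S)        = refl
  #indQ-toAlg (ask value S k) = #indQ-toAlg (k (f S))
  #indQ-toAlg (ask indep S k) = cong suc (#indQ-toAlg (k (ind S)))

q : ℚ
q = ℤ.+ 2 / 3

0≤q : 0ℚ ≤ q
0≤q = ≤ᵇ⇒≤ tt

-- q² ≤ 1/2, so every two rounds halve the threshold; the 5 extra halvings beat the factor 18 in
-- slack-after-rounds.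
roundCount : ℕ → ℕ
roundCount k = 2 ℕ.* (suc ⌊log₂ k ⌋ ℕ.+ 5)

module _ {n : ℕ} where

  greedyStep : Subset n → Fin n → Query n (Subset n)
  greedyStep B x = query indep (B ∪ ⁅ x ⁆) >>= λ b → pure (if b then B ∪ ⁅ x ⁆ else B)

  maxSingletonStep : ℚ → Fin n → Query n ℚ
  maxSingletonStep d x = query value ⁅ x ⁆ >>= λ a → pure (d ⊔ a)

  thresholdStep : ℚ → Subset n → Fin n → Query n (Subset n)
  thresholdStep u S x = query indep (S ∪ ⁅ x ⁆) >>= λ where
    false → pure S
    true  → query value (S ∪ ⁅ x ⁆) >>= λ a → query value S >>= λ c →
            pure (if does (c + 2 * u ≤? a) then S ∪ ⁅ x ⁆ else S)

  thresholdRounds : ℕ → ℚ → Subset n → Query n (Subset n)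
  thresholdRounds zero    u S = pure S
  thresholdRounds (suc r) u S = foldM (thresholdStep u) S (allFin n) >>= thresholdRounds r (q * u)

algorithm : (n : ℕ) → Query n (Subset n)
algorithm n =
  foldM greedyStep ⊥ (allFin n)        >>= λ B →
  foldM maxSingletonStep 0ℚ (allFin n) >>= λ d →
  thresholdRounds (roundCount ∣ B ∣) d ⊥

module Cost {n : ℕ} (f : SetFn n) (ind : Subset n → Bool) where
  open Semantics f ind

  greedyStep-cost : ∀ o B x → count o (greedyStep B x) ≤ℕ 1
  greedyStep-cost o B x = ℕ.≤-trans (ℕ.≤-reflexive (ℕ.+-identityʳ (δ o indep))) (δ≤1 o indep)

  maxSingletonStep-cost : ∀ o d x → count o (maxSingletonStep d x) ≤ℕ 1
  maxSingletonStep-cost o d x = ℕ.≤-trans (ℕ.≤-reflexive (ℕ.+-identityʳ (δ o value))) (δ≤1 o value)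

  thresholdStep-cost : ∀ o u S x → count o (thresholdStep u S x) ≤ℕ 2
  thresholdStep-cost value u S x with ind (S ∪ ⁅ x ⁆)
  ... | false = z≤n
  ... | true  = ℕ.≤-refl
  thresholdStep-cost indep u S x with ind (S ∪ ⁅ x ⁆)
  ... | false = s≤s z≤n
  ... | true  = s≤s z≤n

  foldM-allFin-cost : ∀ {A : Set} {step : A → Fin n → Query n A} o c → (∀ a x → count o (step a x) ≤ℕ c) →
                      ∀ a → count o (foldM step a (allFin n)) ≤ℕ n ℕ.* c
  foldM-allFin-cost {step = step} o c bounded a =
    subst (λ m → count o (foldM step a (allFin n)) ≤ℕ m ℕ.* c) (length-tabulate {n = n} id) (count-foldM o c bounded (allFin n) a)

  thresholdRounds-cost : ∀ o r u S → count o (thresholdRounds r u S) ≤ℕ r ℕ.* (n ℕ.* 2)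
  thresholdRounds-cost o zero    u S = z≤n
  thresholdRounds-cost o (suc r) u S = begin
    count o (thresholdRounds (suc r) u S)                                  ≡⟨ count->>= o pass _ ⟩
    count o pass ℕ.+ count o (thresholdRounds r (q * u) (eval pass))       ≤⟨ ℕ.+-mono-≤ (foldM-allFin-cost o 2 (thresholdStep-cost o u) S)
                                                                                        (thresholdRounds-cost o r (q * u) (eval pass)) ⟩
    n ℕ.* 2 ℕ.+ r ℕ.* (n ℕ.* 2)                                            ∎
    where
    open ℕ.≤-Reasoning
    pass = foldM (thresholdStep u) S (allFin n)

  algorithm-cost : ∀ o → count o (algorithm n) ≤ℕ
                   n ℕ.* 1 ℕ.+ (n ℕ.* 1 ℕ.+ roundCount ∣ eval (foldM greedyStep ⊥ (allFin n)) ∣ ℕ.* (n ℕ.* 2))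
  algorithm-cost o = begin
    count o (algorithm n)                                      ≡⟨ count->>= o greedy _ ⟩
    count o greedy ℕ.+ count o (maximum >>= rounds)            ≡⟨ cong (count o greedy ℕ.+_) (count->>= o maximum rounds) ⟩
    count o greedy ℕ.+ (count o maximum ℕ.+ count o (rounds (eval maximum)))
      ≤⟨ ℕ.+-mono-≤ (foldM-allFin-cost o 1 (greedyStep-cost o) ⊥)
           (ℕ.+-mono-≤ (foldM-allFin-cost o 1 (maxSingletonStep-cost o) 0ℚ) (thresholdRounds-cost o (roundCount ∣ eval greedy ∣) (eval maximum) ⊥)) ⟩
    n ℕ.* 1 ℕ.+ (n ℕ.* 1 ℕ.+ roundCount ∣ eval greedy ∣ ℕ.* (n ℕ.* 2)) ∎
    where
    open ℕ.≤-Reasoning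
    greedy  = foldM greedyStep ⊥ (allFin n)
    maximum = foldM maxSingletonStep 0ℚ (allFin n)
    rounds  = λ d → thresholdRounds (roundCount ∣ eval greedy ∣) d ⊥

budget-bound : ∀ n L → n ℕ.* 1 ℕ.+ (n ℕ.* 1 ℕ.+ 2 ℕ.* (suc L ℕ.+ 5) ℕ.* (n ℕ.* 2)) ≤ℕ 26 ℕ.* (n ℕ.* suc L)
budget-bound n L = ℕ.≤-trans (ℕ.m≤m+n _ (22 ℕ.* (n ℕ.* L))) (ℕ.≤-reflexive (identity n L))
  where
  identity : ∀ n L → n ℕ.* 1 ℕ.+ (n ℕ.* 1 ℕ.+ 2 ℕ.* (suc L ℕ.+ 5) ℕ.* (n ℕ.* 2)) ℕ.+ 22 ℕ.* (n ℕ.* L)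
                     ≡ 26 ℕ.* (n ℕ.* suc L)
  identity = ℕ-solve-∀

fromℕ : ℕ → ℚ
fromℕ m = m ×ℚ 1ℚ

fromℕ-nonNeg : ∀ m → 0ℚ ≤ fromℕ m
fromℕ-nonNeg zero    = ≤-refl
fromℕ-nonNeg (suc m) = +-mono-≤ 0≤1 (fromℕ-nonNeg m)

fromℕ-mono : ∀ {m m′} → m ≤ℕ m′ → fromℕ m ≤ fromℕ m′
fromℕ-mono {m′ = m′} z≤n     = fromℕ-nonNeg m′
fromℕ-mono (s≤s m≤m′) = +-monoʳ-≤ 1ℚ (fromℕ-mono m≤m′)

fromℕ-^ : ∀ m j → fromℕ (m ℕ.^ j) ≡ fromℕ m ^ j
fromℕ-^ m zero    = refl
fromℕ-^ m (suc j) = trans (×1-homo-* m (m ℕ.^ j)) (cong (fromℕ m *_) (fromℕ-^ m j))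

^-nonNeg : ∀ {x} → 0ℚ ≤ x → ∀ j → 0ℚ ≤ x ^ j
^-nonNeg 0≤x zero    = 0≤1
^-nonNeg 0≤x (suc j) = 0≤p∧0≤q⇒0≤p*q 0≤x (^-nonNeg 0≤x j)

^-≤1 : ∀ {x} → 0ℚ ≤ x → x ≤ 1ℚ → ∀ j → x ^ j ≤ 1ℚ
^-≤1 0≤x x≤1 zero    = ≤-refl
^-≤1 {x} 0≤x x≤1 (suc j) = begin
  x * x ^ j ≤⟨ *-monoˡ-≤-nonNeg x {{nonNegative 0≤x}} (^-≤1 0≤x x≤1 j) ⟩
  x * 1ℚ    ≡⟨ *-identityʳ x ⟩
  x         ≤⟨ x≤1 ⟩
  1ℚ        ∎
  where open ≤-Reasoning

k<2^[1+⌊log₂k⌋] : ∀ k → k <ℕ 2 ℕ.^ suc ⌊log₂ k ⌋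
k<2^[1+⌊log₂k⌋] k with k ℕ.<? 2 ℕ.^ suc ⌊log₂ k ⌋
... | yes k<2^ = k<2^
... | no  k≮2^ = contradiction
  (subst (ℕ._≤ ⌊log₂ k ⌋) (⌊log₂[2^n]⌋≡n (suc ⌊log₂ k ⌋)) (⌊log₂⌋-mono-≤ (ℕ.≮⇒≥ k≮2^)))
  ℕ.1+n≰n

18k≤2^[⌊log₂k⌋+6] : ∀ k → 18 ℕ.* k ≤ℕ 2 ℕ.^ (suc ⌊log₂ k ⌋ ℕ.+ 5)
18k≤2^[⌊log₂k⌋+6] k = begin
  18 ℕ.* k                          ≤⟨ ℕ.*-monoˡ-≤ k (ℕ.m≤m+n 18 14) ⟩
  32 ℕ.* k                          ≤⟨ ℕ.*-monoʳ-≤ 32 (ℕ.<⇒≤ (k<2^[1+⌊log₂k⌋] k)) ⟩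
  32 ℕ.* 2 ℕ.^ suc ⌊log₂ k ⌋        ≡⟨ ℕ.*-comm 32 (2 ℕ.^ suc ⌊log₂ k ⌋) ⟩
  2 ℕ.^ suc ⌊log₂ k ⌋ ℕ.* 2 ℕ.^ 5   ≡⟨ sym (ℕ.^-distribˡ-+-* 2 (suc ⌊log₂ k ⌋) 5) ⟩
  2 ℕ.^ (suc ⌊log₂ k ⌋ ℕ.+ 5)       ∎
  where open ℕ.≤-Reasoning

roundCount-suffices : ∀ k → fromℕ (18 ℕ.* k) * q ^ roundCount k ≤ 1ℚ
roundCount-suffices k = begin
  fromℕ (18 ℕ.* k) * q ^ (2 ℕ.* j)  ≤⟨ *-monoʳ-≤-nonNeg (q ^ (2 ℕ.* j)) {{nonNegative (^-nonNeg 0≤q (2 ℕ.* j))}}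
                                                         (fromℕ-mono (18k≤2^[⌊log₂k⌋+6] k)) ⟩
  fromℕ (2 ℕ.^ j) * q ^ (2 ℕ.* j)   ≡⟨ cong₂ _*_ (fromℕ-^ 2 j) (sym (^-assocʳ q 2 j)) ⟩
  fromℕ 2 ^ j * (q ^ 2) ^ j         ≡⟨ sym (^-distrib-* (fromℕ 2) (q ^ 2) j) ⟩
  (fromℕ 2 * q ^ 2) ^ j             ≤⟨ ^-≤1 0≤2q² 2q²≤1 j ⟩
  1ℚ                                ∎
  where
  open ≤-Reasoning
  j = suc ⌊log₂ k ⌋ ℕ.+ 5
  0≤2q² : 0ℚ ≤ fromℕ 2 * q ^ 2
  0≤2q² = ≤ᵇ⇒≤ tt
  2q²≤1 : fromℕ 2 * q ^ 2 ≤ 1ℚ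
  2q²≤1 = ≤ᵇ⇒≤ tt

potential-update : ∀ {t w w′ s s′ u} → 2 * t ≤ 2 * w + 3 * s → w ≤ w′ + 3 * u → s + 2 * u ≤ s′ →
                   2 * t ≤ 2 * w′ + 3 * s′
potential-update {t} {w} {w′} {s} {s′} {u} dominated loss gain = begin
  2 * t                     ≤⟨ dominated ⟩
  2 * w + 3 * s             ≤⟨ +-monoˡ-≤ (3 * s) (*-monoˡ-≤-nonNeg 2 loss) ⟩
  2 * (w′ + 3 * u) + 3 * s  ≡⟨ regroup w′ u s ⟩
  2 * w′ + 3 * (s + 2 * u)  ≤⟨ +-monoʳ-≤ (2 * w′) (*-monoˡ-≤-nonNeg 3 gain) ⟩
  2 * w′ + 3 * s′           ∎
  where
  open ≤-Reasoning
  regroup : ∀ a b c → 2 * (a + 3 * b) + 3 * c ≡ 2 * a + 3 * (c + 2 * b)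
  regroup = solve-∀ ℚ-ring

slack-absorbed : ∀ {t t* s e d} → 2 * t ≤ 5 * s + 2 * e → 2 * t* ≤ 5 * s + 2 * e → d ≤ t* → 6 * e ≤ d →
                 t ≤ 3 * s
slack-absorbed {t} {t*} {s} {e} {d} bound-t bound-t* d≤t* 6e≤d = *-cancelˡ-≤-pos 2 (begin
  2 * t          ≤⟨ bound-t ⟩
  5 * s + 2 * e  ≤⟨ +-monoʳ-≤ (5 * s) 2e≤s ⟩
  5 * s + s      ≡⟨ identity₁ s ⟩
  2 * (3 * s)    ∎)
  where
  open ≤-Reasoning
  identity₁ : ∀ a → 5 * a + a ≡ 2 * (3 * a)
  identity₁ = solve-∀ ℚ-ring
  identity₂ : ∀ a → 5 * a + a ≡ 3 * (2 * a)
  identity₂ = solve-∀ ℚ-ring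
  identity₃ : ∀ a b → 3 * (5 * a + 2 * b) ≡ 5 * (3 * a) + 6 * b
  identity₃ = solve-∀ ℚ-ring
  identity₄ : ∀ a → 3 * (2 * a) ≡ 6 * a
  identity₄ = solve-∀ ℚ-ring
  t*≤3s : t* ≤ 3 * s
  t*≤3s = *-cancelˡ-≤-pos 5 (+-cancelʳ-≤ t* (begin
    5 * t* + t*          ≡⟨ identity₂ t* ⟩
    3 * (2 * t*)         ≤⟨ *-monoˡ-≤-nonNeg 3 bound-t* ⟩
    3 * (5 * s + 2 * e)  ≡⟨ identity₃ s e ⟩
    5 * (3 * s) + 6 * e  ≤⟨ +-monoʳ-≤ (5 * (3 * s)) (≤-trans 6e≤d d≤t*) ⟩
    5 * (3 * s) + t*     ∎))
  2e≤s : 2 * e ≤ s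
  2e≤s = *-cancelˡ-≤-pos 3 (begin
    3 * (2 * e)  ≡⟨ identity₄ e ⟩
    6 * e        ≤⟨ 6e≤d ⟩
    d            ≤⟨ d≤t* ⟩
    t*           ≤⟨ t*≤3s ⟩
    3 * s        ∎)

slack-after-rounds : ∀ k {d} → 0ℚ ≤ d → 6 * (fromℕ k * (3 * (q ^ roundCount k * d))) ≤ d
slack-after-rounds k {d} 0≤d = begin
  6 * (fromℕ k * (3 * (x * d)))  ≡⟨ regroup (fromℕ k) x d ⟩
  18 * fromℕ k * x * d           ≡⟨ cong (λ c → c * x * d) (sym (×1-homo-* 18 k)) ⟩
  fromℕ (18 ℕ.* k) * x * d       ≤⟨ *-monoʳ-≤-nonNeg d {{nonNegative 0≤d}} (roundCount-suffices k) ⟩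
  1ℚ * d                         ≡⟨ *-identityˡ d ⟩
  d                              ∎
  where
  open ≤-Reasoning
  x = q ^ roundCount k
  regroup : ∀ a b c → 6 * (a * (3 * (b * c))) ≡ 18 * a * b * c
  regroup = solve-∀ ℚ-ring

module Analysis {n : ℕ} {f : SetFn n} {ind : Subset n → Bool} (M : IsMatroid ind)
                (nonneg : NonNegative f) (mono : Monotone f) (submod : Submodular f) where
  open IsMatroid M
  open MatroidProperties M
  open Semantics f ind

  false⇒dependent : ∀ {X} → ind X ≡ false → ¬ Indep ind X
  false⇒dependent ind-X≡false iX = contradiction (trans (sym ind-X≡false) iX) λ ()

  GainAtMost : ℚ → Subset n → Fin n → Set
  GainAtMost W S y = Indep ind (S ∪ ⁅ y ⁆) → f (S ∪ ⁅ y ⁆) ≤ f S + W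

  gain-mono : ∀ {W S X} y → S ⊆ X → GainAtMost W S y → GainAtMost W X y
  gain-mono {W} {S} {X} y S⊆X gain iX∪y = +-cancelʳ-≤ (f S) (begin
    f (X ∪ ⁅ y ⁆) + f S  ≤⟨ diminishing-returns mono submod y S⊆X ⟩
    f X + f (S ∪ ⁅ y ⁆)  ≤⟨ +-monoʳ-≤ (f X) (gain (hereditary _ _ (∪-mono S⊆X ⊆-refl) iX∪y)) ⟩
    f X + (f S + W)      ≡⟨ regroup (f X) (f S) W ⟩
    f X + W + f S        ∎)
    where
    open ≤-Reasoning
    regroup : ∀ a b c → a + (b + c) ≡ a + c + b
    regroup = solve-∀ ℚ-ring

  gain-removal : ∀ {W S O o} → o ∈ O → Indep ind (S ∪ O) → GainAtMost W S o → f (S ∪ O) ≤ f (S ∪ (O - o)) + W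
  gain-removal {W} {S} {O} {o} o∈O iS∪O gain =
    ≤-trans (mono _ _ S∪O⊆) (gain-mono o (p⊆p∪q (O - o)) gain (hereditary _ _ ⊆S∪O iS∪O))
    where
    S∪O⊆ : S ∪ O ⊆ (S ∪ (O - o)) ∪ ⁅ o ⁆
    S∪O⊆ = ⊆-trans (∪-mono ⊆-refl (p⊆p-x∪⁅x⁆ O o)) (⊆-reflexive (sym (∪-assoc S (O - o) ⁅ o ⁆)))
    ⊆S∪O : (S ∪ (O - o)) ∪ ⁅ o ⁆ ⊆ S ∪ O
    ⊆S∪O = ∪-lub (∪-mono ⊆-refl (p─q⊆p O ⁅ o ⁆)) (q⊆p∪q S O ∘ x∈p⇒⁅x⁆⊆p o∈O)

  union-bound-empty : ∀ {W S O} m → 0ℚ ≤ W → (∀ {o} → o ∉ O) → f (S ∪ O) ≤ f S + fromℕ m * W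
  union-bound-empty m 0≤W o∉O =
    ≤-trans (mono _ _ (∪-lub ⊆-refl (⊥-elim ∘ o∉O))) (p≤p+q (0≤p∧0≤q⇒0≤p*q (fromℕ-nonNeg m) 0≤W))

  union-bound : ∀ {W S} m {O} → 0ℚ ≤ W → (∀ y → GainAtMost W S y) → Indep ind (S ∪ O) → ∣ O ∣ ≤ℕ m →
                f (S ∪ O) ≤ f S + fromℕ m * W
  union-bound zero 0≤W _ _ ∣O∣≤0 =
    union-bound-empty 0 0≤W λ o∈O → ℕ.n≮0 (ℕ.<-≤-trans (x∈p⇒∣p-x∣<∣p∣ o∈O) ∣O∣≤0)
  union-bound {W} {S} (suc m) {O} 0≤W gains iS∪O ∣O∣≤1+m with nonempty? O
  ... | no O-empty = union-bound-empty (suc m) 0≤W λ o∈O → O-empty (_ , o∈O)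
  ... | yes (o , o∈O) = begin
    f (S ∪ O)                ≤⟨ gain-removal o∈O iS∪O (gains o) ⟩
    f (S ∪ (O - o)) + W      ≤⟨ +-monoˡ-≤ W (union-bound m 0≤W gains iS∪O-o ∣O-o∣≤m) ⟩
    f S + fromℕ m * W + W    ≡⟨ regroup (f S) (fromℕ m) W ⟩
    f S + fromℕ (suc m) * W  ∎
    where
    open ≤-Reasoning
    iS∪O-o = hereditary _ _ (∪-mono ⊆-refl (p─q⊆p O ⁅ o ⁆)) iS∪O
    ∣O-o∣≤m = ℕ.≤-pred (ℕ.<-≤-trans (x∈p⇒∣p-x∣<∣p∣ o∈O) ∣O∣≤1+m)
    regroup : ∀ a b c → a + b * c + c ≡ a + (1ℚ + b) * c
    regroup = solve-∀ ℚ-ring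

  -- O is the part of T not yet traded for elements of S.
  Dominates : Subset n → Subset n → Set
  Dominates T S = ∃[ O ] (Indep ind (S ∪ O) × 2 * f T ≤ 2 * f (S ∪ O) + 3 * f S)

  dominates-⊥ : ∀ {T} → Indep ind T → Dominates T ⊥
  dominates-⊥ {T} iT = T , subst (Indep ind) (sym (∪-identityˡ T)) iT , (begin
    2 * f T                  ≡⟨ cong (λ X → 2 * f X) (sym (∪-identityˡ T)) ⟩
    2 * f (⊥ ∪ T)            ≤⟨ p≤p+q (*-monoˡ-≤-nonNeg 3 (nonneg ⊥)) ⟩
    2 * f (⊥ ∪ T) + 3 * f ⊥  ∎)
    where open ≤-Reasoning

  exchange-step : ∀ {W S s O} → 0ℚ ≤ W → (∀ y → GainAtMost W S y) → Indep ind (S ∪ O) → Indep ind (S ∪ ⁅ s ⁆) →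
                  ∃[ O′ ] (Indep ind ((S ∪ ⁅ s ⁆) ∪ O′) × f (S ∪ O) ≤ f ((S ∪ ⁅ s ⁆) ∪ O′) + W)
  exchange-step {W} {S} {s} {O} 0≤W gains iS∪O iS∪s with ind ((S ∪ O) ∪ ⁅ s ⁆) in iS∪O∪s
  ... | true  = O , hereditary _ _ S∪s∪O⊆ iS∪O∪s , ≤-trans (mono _ _ (∪-mono (p⊆p∪q ⁅ s ⁆) ⊆-refl)) (p≤p+q 0≤W)
    where
    S∪s∪O⊆ : (S ∪ ⁅ s ⁆) ∪ O ⊆ (S ∪ O) ∪ ⁅ s ⁆
    S∪s∪O⊆ = ∪-lub (∪-mono (p⊆p∪q O) ⊆-refl) (p⊆p∪q ⁅ s ⁆ ∘ q⊆p∪q S O)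
  ... | false with exchange-into iS∪O (p⊆p∪q O) iS∪s (false⇒dependent iS∪O∪s)
  ...   | o , o∈S∪O , o∉S∪s , i = O - o , hereditary _ _ S∪s∪O-o⊆ i , (begin
    f (S ∪ O)                      ≤⟨ gain-removal o∈O iS∪O (gains o) ⟩
    f (S ∪ (O - o)) + W            ≤⟨ +-monoˡ-≤ W (mono _ _ (∪-mono (p⊆p∪q ⁅ s ⁆) ⊆-refl)) ⟩
    f ((S ∪ ⁅ s ⁆) ∪ (O - o)) + W  ∎)
    where
    open ≤-Reasoning
    o∈O : o ∈ O
    o∈O = [ (λ o∈S → contradiction (p⊆p∪q ⁅ s ⁆ o∈S) o∉S∪s) , id ] (x∈p∪q⁻ S O o∈S∪O)
    S∪s∪O-o⊆ : (S ∪ ⁅ s ⁆) ∪ (O - o) ⊆ ((S ∪ O) ∪ ⁅ s ⁆) - o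
    S∪s∪O-o⊆ = ∪-lub
      (λ v∈S∪s → x∈p∧x≢y⇒x∈p-y (∪-mono (p⊆p∪q O) ⊆-refl v∈S∪s) λ { refl → o∉S∪s v∈S∪s })
      (λ v∈O-o → x∈p∧x≢y⇒x∈p-y (p⊆p∪q ⁅ s ⁆ (q⊆p∪q S O (p─q⊆p O ⁅ o ⁆ v∈O-o))) (x∈p-y⇒x≢y O v∈O-o))

  dominates-add : ∀ {u S s T} → 0ℚ ≤ u → (∀ y → GainAtMost (3 * u) S y) → Indep ind (S ∪ ⁅ s ⁆) →
                  f S + 2 * u ≤ f (S ∪ ⁅ s ⁆) → Dominates T S → Dominates T (S ∪ ⁅ s ⁆)
  dominates-add {u} {S} {s} {T} 0≤u gains iS∪s gain (O , iS∪O , dominated)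
    with exchange-step (*-monoˡ-≤-nonNeg 3 0≤u) gains iS∪O iS∪s
  ... | O′ , iO′ , loss =
    O′ , iO′ , potential-update {f T} {f (S ∪ O)} {f ((S ∪ ⁅ s ⁆) ∪ O′)} {f S} {f (S ∪ ⁅ s ⁆)} {u} dominated loss gain

  dominates-bound : ∀ {k U S T} → HasRank ind k → 0ℚ ≤ U → (∀ y → GainAtMost U S y) → Dominates T S →
                    2 * f T ≤ 5 * f S + 2 * (fromℕ k * U)
  dominates-bound {k} {U} {S} {T} (_ , rank-bound) 0≤U gains (O , iS∪O , dominated) = begin
    2 * f T                            ≤⟨ dominated ⟩
    2 * f (S ∪ O) + 3 * f S            ≤⟨ +-monoˡ-≤ (3 * f S) (*-monoˡ-≤-nonNeg 2 (union-bound k 0≤U gains iS∪O ∣O∣≤k)) ⟩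
    2 * (f S + fromℕ k * U) + 3 * f S  ≡⟨ regroup (f S) (fromℕ k * U) ⟩
    5 * f S + 2 * (fromℕ k * U)        ∎
    where
    open ≤-Reasoning
    ∣O∣≤k = rank-bound O (hereditary _ _ (q⊆p∪q S O) iS∪O)
    regroup : ∀ a b → 2 * (a + b) + 3 * a ≡ 5 * a + 2 * b
    regroup = solve-∀ ℚ-ring

  -- The state at the start of a round with threshold 2u; the bound 3u on gains is 2u/q, left by the
  -- previous round.
  record Invariant (u : ℚ) (S : Subset n) : Set where
    field
      independent : Indep ind S
      gains       : ∀ y → GainAtMost (3 * u) S y
      dominates   : ∀ T → Indep ind T → Dominates T S
  open Invariant

  initial-invariant : ∀ {d} → 0ℚ ≤ d → (∀ y → f ⁅ y ⁆ ≤ d) → Invariant d ⊥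
  initial-invariant {d} 0≤d singletons = record
    { independent = empty-indep
    ; gains       = λ y _ → begin
        f (⊥ ∪ ⁅ y ⁆)  ≡⟨ cong f (∪-identityˡ ⁅ y ⁆) ⟩
        f ⁅ y ⁆        ≤⟨ singletons y ⟩
        d              ≤⟨ p≤p+q (*-monoˡ-≤-nonNeg 2 0≤d) ⟩
        d + 2 * d      ≡⟨ regroup d ⟩
        0ℚ + 3 * d     ≤⟨ +-monoˡ-≤ (3 * d) (nonneg ⊥) ⟩
        f ⊥ + 3 * d    ∎
    ; dominates   = λ T → dominates-⊥
    }
    where
    open ≤-Reasoning
    regroup : ∀ a → a + 2 * a ≡ 0ℚ + 3 * a
    regroup = solve-∀ ℚ-ring

  thresholdStep-spec : ∀ {u S} x → 0ℚ ≤ u → Invariant u S →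
                       let S′ = eval (thresholdStep u S x) in
                       S ⊆ S′ × Invariant u S′ × GainAtMost (2 * u) S′ x
  thresholdStep-spec {u} {S} x 0≤u inv with ind (S ∪ ⁅ x ⁆) in iS∪x
  ... | false = ⊆-refl , inv , ⊥-elim ∘ false⇒dependent iS∪x
  ... | true = by-gain (f S + 2 * u ≤? f (S ∪ ⁅ x ⁆))
    where
    -- `with` cannot abstract the decision here: _≤?_ unfolds inside eval.
    by-gain : (large? : Dec (f S + 2 * u ≤ f (S ∪ ⁅ x ⁆))) →
              let S′ = if does large? then S ∪ ⁅ x ⁆ else S in
              S ⊆ S′ × Invariant u S′ × GainAtMost (2 * u) S′ x
    by-gain (no small)  = ⊆-refl , inv , λ _ → <⇒≤ (≰⇒> small)
    by-gain (yes large) = p⊆p∪q ⁅ x ⁆ , inv′ , λ _ → ≤-trans (mono _ _ absorb) (p≤p+q (*-monoˡ-≤-nonNeg 2 0≤u))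
      where
      inv′ : Invariant u (S ∪ ⁅ x ⁆)
      inv′ = record
        { independent = iS∪x
        ; gains       = λ y → gain-mono y (p⊆p∪q ⁅ x ⁆) (gains inv y)
        ; dominates   = λ T iT → dominates-add 0≤u (gains inv) iS∪x large (dominates inv T iT)
        }
      absorb : (S ∪ ⁅ x ⁆) ∪ ⁅ x ⁆ ⊆ S ∪ ⁅ x ⁆
      absorb = ∪-lub ⊆-refl (q⊆p∪q S ⁅ x ⁆)

  thresholdPass-spec : ∀ {u S} → 0ℚ ≤ u → Invariant u S →
                       let S′ = eval (foldM (thresholdStep u) S (allFin n)) in
                       Invariant u S′ × (∀ y → GainAtMost (2 * u) S′ y)
  thresholdPass-spec {u} 0≤u inv =
    foldM-preserves (Invariant u) preserve (allFin n) inv ,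
    λ y → foldM-establishes (Invariant u) (λ y S → GainAtMost (2 * u) S y) preserve establish keep (allFin n) inv (∈-allFin y)
    where
    preserve : ∀ {S} x → Invariant u S → Invariant u (eval (thresholdStep u S x))
    preserve x inv = proj₁ (proj₂ (thresholdStep-spec x 0≤u inv))
    establish : ∀ {S} x → Invariant u S → GainAtMost (2 * u) (eval (thresholdStep u S x)) x
    establish x inv = proj₂ (proj₂ (thresholdStep-spec x 0≤u inv))
    keep : ∀ {S} x y → Invariant u S → GainAtMost (2 * u) S y → GainAtMost (2 * u) (eval (thresholdStep u S x)) y
    keep x y inv = gain-mono y (proj₁ (thresholdStep-spec x 0≤u inv))

  thresholdRounds-invariant : ∀ r {u S} → 0ℚ ≤ u → Invariant u S → Invariant (q ^ r * u) (eval (thresholdRounds r u S))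
  thresholdRounds-invariant zero    {u} 0≤u inv = subst (λ v → Invariant v _) (sym (*-identityˡ u)) inv
  thresholdRounds-invariant (suc r) {u} {S} 0≤u inv =
    subst₂ Invariant (regroup (q ^ r) q u) (sym (eval->>= pass (thresholdRounds r (q * u))))
      (thresholdRounds-invariant r (*-monoˡ-≤-nonNeg q {{nonNegative 0≤q}} 0≤u) inv′)
    where
    pass = foldM (thresholdStep u) S (allFin n)
    regroup : ∀ a b c → a * (b * c) ≡ b * a * c
    regroup = solve-∀ ℚ-ring
    inv′ : Invariant (q * u) (eval pass)
    inv′ = let passed , saturated = thresholdPass-spec 0≤u inv in record
      { independent = independent passed
      ; gains       = λ y → subst (λ W → GainAtMost W (eval pass) y) (*-assoc 3 q u) (saturated y)
      ; dominates   = dominates passed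
      }

  greedyStep-spec : ∀ {B} x → Indep ind B →
                    let B′ = eval (greedyStep B x) in
                    B ⊆ B′ × Indep ind B′ × (Indep ind (B′ ∪ ⁅ x ⁆) → x ∈ B′)
  greedyStep-spec {B} x iB with ind (B ∪ ⁅ x ⁆) in iB∪x
  ... | true  = p⊆p∪q ⁅ x ⁆ , iB∪x , λ _ → q⊆p∪q B ⁅ x ⁆ (x∈⁅x⁆ x)
  ... | false = ⊆-refl , iB , ⊥-elim ∘ false⇒dependent iB∪x

  greedy-maximal : let B = eval (foldM greedyStep ⊥ (allFin n)) in
                   Indep ind B × (∀ x → Indep ind (B ∪ ⁅ x ⁆) → x ∈ B)
  greedy-maximal =
    foldM-preserves (Indep ind) preserve (allFin n) empty-indep ,
    λ x → foldM-establishes (Indep ind) (λ x B → Indep ind (B ∪ ⁅ x ⁆) → x ∈ B) preserve establish keep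
                            (allFin n) empty-indep (∈-allFin x)
    where
    preserve : ∀ {B} x → Indep ind B → Indep ind (eval (greedyStep B x))
    preserve x iB = proj₁ (proj₂ (greedyStep-spec x iB))
    establish : ∀ {B} x → Indep ind B → let B′ = eval (greedyStep B x) in Indep ind (B′ ∪ ⁅ x ⁆) → x ∈ B′
    establish x iB = proj₂ (proj₂ (greedyStep-spec x iB))
    keep : ∀ {B} x y → Indep ind B → (Indep ind (B ∪ ⁅ y ⁆) → y ∈ B) →
           let B′ = eval (greedyStep B x) in Indep ind (B′ ∪ ⁅ y ⁆) → y ∈ B′
    keep x y iB saturated iB′∪y = B⊆B′ (saturated (hereditary _ _ (∪-mono B⊆B′ ⊆-refl) iB′∪y))
      where B⊆B′ = proj₁ (greedyStep-spec x iB)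

  greedy-size : ∀ {k} → HasRank ind k → ∣ eval (foldM greedyStep ⊥ (allFin n)) ∣ ≡ k
  greedy-size rank = maximal⇒∣B∣≡rank rank (proj₁ greedy-maximal) (proj₂ greedy-maximal)

  Attained : ℚ → Set
  Attained d = ∃[ T ] (Indep ind T × d ≤ f T)

  maxSingleton-spec : (∀ y → Attained (f ⁅ y ⁆)) →
                      let d = eval (foldM maxSingletonStep 0ℚ (allFin n)) in
                      (0ℚ ≤ d × Attained d) × (∀ y → f ⁅ y ⁆ ≤ d)
  maxSingleton-spec attained =
    foldM-preserves Inv preserve (allFin n) start ,
    λ y → foldM-establishes Inv (λ y d → f ⁅ y ⁆ ≤ d) preserve (λ {d} x _ → p≤q⊔p d (f ⁅ x ⁆))
                            (λ {d} x y _ fy≤d → ≤-trans fy≤d (p≤p⊔q d (f ⁅ x ⁆))) (allFin n) start (∈-allFin y)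
    where
    Inv : ℚ → Set
    Inv d = 0ℚ ≤ d × Attained d
    start : Inv 0ℚ
    start = ≤-refl , ⊥ , empty-indep , nonneg ⊥
    preserve : ∀ {d} x → Inv d → Inv (d ⊔ f ⁅ x ⁆)
    preserve {d} x (0≤d , attained-d) =
      p≤q⇒p≤q⊔r (f ⁅ x ⁆) 0≤d ,
      [ (λ eq → subst Attained (sym eq) attained-d) , (λ eq → subst Attained (sym eq) (attained x)) ]′ (⊔-sel d (f ⁅ x ⁆))

  algorithm-approximation : ∀ {k} → HasRank ind k → (∀ y → Attained (f ⁅ y ⁆)) →
                            Indep ind (eval (algorithm n)) × (∀ T → Indep ind T → f T ≤ 3 * f (eval (algorithm n)))
  algorithm-approximation {k} rank attained = subst Approximate (sym output) (independent inv , approximate)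
    where
    Approximate : Subset n → Set
    Approximate S = Indep ind S × (∀ T → Indep ind T → f T ≤ 3 * f S)
    greedy  = foldM greedyStep ⊥ (allFin n)
    maximum = foldM maxSingletonStep 0ℚ (allFin n)
    d = eval maximum
    R = roundCount k
    S = eval (thresholdRounds R d ⊥)
    output : eval (algorithm n) ≡ S
    output = begin
      eval (algorithm n)                                        ≡⟨ eval->>= greedy _ ⟩
      eval (maximum >>= λ d → thresholdRounds (roundCount ∣ eval greedy ∣) d ⊥)
                                                                ≡⟨ eval->>= maximum _ ⟩
      eval (thresholdRounds (roundCount ∣ eval greedy ∣) d ⊥)  ≡⟨ cong (λ m → eval (thresholdRounds (roundCount m) d ⊥))
                                                                       (greedy-size rank) ⟩
      S                                                         ∎
      where open ≡-Reasoning
    bounds = maxSingleton-spec attained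
    0≤d = proj₁ (proj₁ bounds)
    inv = thresholdRounds-invariant R 0≤d (initial-invariant 0≤d (proj₂ bounds))
    U = 3 * (q ^ R * d)
    0≤U : 0ℚ ≤ U
    0≤U = *-monoˡ-≤-nonNeg 3 (0≤p∧0≤q⇒0≤p*q (^-nonNeg 0≤q R) 0≤d)
    dominated : ∀ T → Indep ind T → 2 * f T ≤ 5 * f S + 2 * (fromℕ k * U)
    dominated T iT = dominates-bound rank 0≤U (gains inv) (dominates inv T iT)
    approximate : ∀ T → Indep ind T → f T ≤ 3 * f S
    approximate T iT with proj₂ (proj₁ bounds)
    ... | T* , iT* , d≤fT* =
      slack-absorbed {f T} {f T*} {f S} {fromℕ k * U} {d} (dominated T iT) (dominated T* iT*) d≤fT* (slack-after-rounds k 0≤d)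

  algorithm-queries : ∀ {k} → HasRank ind k → ∀ o → count o (algorithm n) ≤ℕ budget 26 n k
  algorithm-queries {k} rank o =
    ℕ.≤-trans (Cost.algorithm-cost f ind o)
      (subst (λ m → n ℕ.* 1 ℕ.+ (n ℕ.* 1 ℕ.+ roundCount m ℕ.* (n ℕ.* 2)) ≤ℕ budget 26 n k)
             (sym (greedy-size rank)) (budget-bound n ⌊log₂ k ⌋))

lemma3p3 :
    Σ ℕ λ C → Σ ((n : ℕ) → Alg n) λ A →
      ∀ (n k : ℕ) (f : SetFn n) (ind : Subset n → Bool) →
      IsMatroid ind → HasRank ind k →
      NonNegative f → Monotone f → Submodular f →
      (∀ (u : Fin n) → ∃[ T ] (Indep ind T × f ⁅ u ⁆ ≤ℚ f T)) →
      Indep ind (run (A n) f ind)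
      × (∀ T → Indep ind T →
           f T ≤ℚ ((f (run (A n) f ind) +ℚ f (run (A n) f ind)) +ℚ f (run (A n) f ind)))
      × #valQ (A n) f ind ≤ℕ budget C n k
      × #indQ (A n) f ind ≤ℕ budget C n k
lemma3p3 = 26 , toAlg ∘ algorithm , λ n k f ind M rank nonneg mono submod attained →
  let open Semantics f ind
      open Analysis M nonneg mono submod
      independent , approximate = algorithm-approximation rank attained
      output = sym (run-toAlg (algorithm n))
  in subst (Indep ind) output independent ,
     (λ T iT → subst (λ S → f T ≤ f S + f S + f S) output
                     (subst (f T ≤_) (thrice (f (eval (algorithm n)))) (approximate T iT))) ,
     subst (_≤ℕ budget 26 n k) (sym (#valQ-toAlg (algorithm n))) (algorithm-queries rank value) ,
     subst (_≤ℕ budget 26 n k) (sym (#indQ-toAlg (algorithm n))) (algorithm-queries rank indep)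
  where
  thrice : ∀ a → 3 * a ≡ a + a + a
  thrice = solve-∀ ℚ-ring
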